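{- Let $\mathsf{C}$ and $\mathsf{D}$ be optiongraphs and let $f:\mathsf{C}\to\mathsf{D}$ be an option-preserving surjection. Then $f(F_{\mathsf{C}})=F_{\mathsf{D}}$, $f(I_{\mathsf{C}})=I_{\mathsf{D}}$, and $f(M_{\mathsf{C}})=M_{\mathsf{D}}$.
   Context: An optiongraph is a nonempty set $\mathsf{D}$ (of positions, possibly infinite) together with an option function $\mathrm{Opt}_{\mathsf{D}}:\mathsf{D}\to 2^{\mathsf{D}}$; it is viewed as a digraph with an arrow $p\to q$ iff $q\in\mathrm{Opt}(p)$. A function $f:\mathsf{C}\to\mathsf{D}$ is option preserving if $\mathrm{Opt}_{\mathsf{D}}(f(p))=f(\mathrm{Opt}_{\mathsf{C}}(p))$ for all $p\in\mathsf{C}$. A position $q$ is a subposition of $p$ if there is a finite walk (possibly of length $0$) from $p$ to $q$; a terminal position is one with empty option set. A play from $p$ is a walk starting at $p$ that either is infinite or ends at a terminal position. $I_{\mathsf{D}}$ is the set of positions with no terminal subposition; $F_{\mathsf{D}}$ is the set of positions that are not the starting vertex of any infinite play (infinite walk); $M_{\mathsf{D}}:=\mathsf{D}\setminus(F_{\mathsf{D}}\cup I_{\mathsf{D}})$. -}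

module Defs where

open import Level using (0ℓ)
open import Data.Nat using (ℕ; suc)
open import Data.Product using (Σ; _×_; ∃; ∃-syntax)
open import Relation.Nullary using (¬_)
open import Relation.Unary using (Pred; _∈_)
open import Relation.Binary.PropositionalEquality using (_≡_)
open import Function.Bundles using (_⇔_)

record OptionGraph : Set₁ where
  field
    Pos      : Set
    Opt      : Pos → Pred Pos 0ℓ
    nonempty : Pos

open OptionGraph public

Image : {A B : Set} → (A → B) → Pred A 0ℓ → Pred B 0ℓ
Image f X b = ∃[ a ] (a ∈ X × f a ≡ b)

_≐_ : {A : Set} → Pred A 0ℓ → Pred A 0ℓ → Set
X ≐ Y = ∀ a → (a ∈ X) ⇔ (a ∈ Y)

OptionPreserving : (C D : OptionGraph) → (Pos C → Pos D) → Set
OptionPreserving C D f = ∀ p → Opt D (f p) ≐ Image f (Opt C p)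

Surjective : {A B : Set} → (A → B) → Set
Surjective {A} {B} f = ∀ b → ∃[ a ] (f a ≡ b)

module _ (G : OptionGraph) where

  data Reach : Pos G → Pos G → Set where
    here  : ∀ {p} → Reach p p
    step  : ∀ {p q r} → Opt G p q → Reach q r → Reach p r

  Terminal : Pos G → Set
  Terminal p = ∀ q → ¬ Opt G p q

  InfiniteWalkFrom : Pos G → Set
  InfiniteWalkFrom p = Σ (ℕ → Pos G) λ s → (s 0 ≡ p) × (∀ n → Opt G (s n) (s (suc n)))

  Iset : Pred (Pos G) 0ℓ
  Iset p = ¬ (∃[ q ] (Reach p q × Terminal q))

  Fset : Pred (Pos G) 0ℓ
  Fset p = ¬ InfiniteWalkFrom p

  Mset : Pred (Pos G) 0ℓ
  Mset p = ¬ (Fset p) × ¬ (Iset p)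

{-# OPTIONS --safe #-}
module Submission where

-- An option-preserving map f sends walks to walks, and conversely every walk
-- out of f c lifts, one step at a time, to a walk out of c; likewise c is
-- terminal iff f c is.  Hence c ∈ X_C iff f c ∈ X_D for X = F, I, M, i.e.
-- each X_C is the preimage of X_D, and a surjection maps a preimage onto
-- the set itself.

open import Defs
open import Data.Nat using (ℕ; zero; suc)
open import Data.Product using (Σ-syntax; ∃-syntax; _×_; _,_; proj₁; proj₂)
open import Data.Product.Function.NonDependent.Propositional using (_×-⇔_)
open import Function.Base using (_∘_)
open import Function.Bundles using (_⇔_; mk⇔; module Equivalence)
open import Function.Related.TypeIsomorphisms using (¬-cong-⇔)
open import Level using (0ℓ)
open import Relation.Unary using (Pred)
open import Relation.Binary.PropositionalEquality using (_≡_; refl; sym; subst)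

surjective⇒image-preimage : {A B : Set} {f : A → B} {P : Pred A 0ℓ} {Q : Pred B 0ℓ}
  → Surjective f → (∀ a → P a ⇔ Q (f a)) → Image f P ≐ Q
surjective⇒image-preimage {Q = Q} surj P⇔Qf b = mk⇔
  (λ { (a , Pa , refl) → Equivalence.to (P⇔Qf a) Pa })
  (λ Qb → let (a , fa≡b) = surj b in
    a , Equivalence.from (P⇔Qf a) (subst Q (sym fa≡b) Qb) , fa≡b)

HasTerminalSubposition : (G : OptionGraph) → Pred (Pos G) 0ℓ
HasTerminalSubposition G p = ∃[ q ] (Reach G p q × Terminal G q)

module OptionMap {C D : OptionGraph} {f : Pos C → Pos D}
  (map-opt : ∀ {p a} → Opt C p a → Opt D (f p) (f a)) where

  reach-map : ∀ {p q} → Reach C p q → Reach D (f p) (f q)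
  reach-map here       = here
  reach-map (step o r) = step (map-opt o) (reach-map r)

  infiniteWalk-map : ∀ {c} → InfiniteWalkFrom C c → InfiniteWalkFrom D (f c)
  infiniteWalk-map (s , refl , steps) = f ∘ s , refl , map-opt ∘ steps

  terminal-reflect : ∀ {c d} → f c ≡ d → Terminal D d → Terminal C c
  terminal-reflect refl t a o = t (f a) (map-opt o)

module OptionLift {C D : OptionGraph} {f : Pos C → Pos D}
  (lift-opt : ∀ {p q} → Opt D (f p) q → Image f (Opt C p) q) where

  lift-opt-at : ∀ {p d q} → f p ≡ d → Opt D d q → Image f (Opt C p) q
  lift-opt-at refl = lift-opt

  reach-lift : ∀ {c d q} → f c ≡ d → Reach D d q → Image f (Reach C c) q
  reach-lift fc≡d here = _ , here , fc≡d
  reach-lift fc≡d (step o r) =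
    let (a , oa , fa≡) = lift-opt-at fc≡d o
        (b , rb , fb≡) = reach-lift fa≡ r
    in b , step oa rb , fb≡

  infiniteWalk-lift : ∀ {c} → InfiniteWalkFrom D (f c) → InfiniteWalkFrom C c
  infiniteWalk-lift {c} (s , s₀≡fc , steps) = proj₁ ∘ lifts , refl , lifts-step
    where
    lifts : (n : ℕ) → Σ[ a ∈ Pos C ] f a ≡ s n
    lifts zero    = c , sym s₀≡fc
    lifts (suc n) = let (a , _ , fa≡) = lift-opt-at (proj₂ (lifts n)) (steps n) in a , fa≡

    lifts-step : ∀ n → Opt C (proj₁ (lifts n)) (proj₁ (lifts (suc n)))
    lifts-step n = proj₁ (proj₂ (lift-opt-at (proj₂ (lifts n)) (steps n)))

  terminal-map : ∀ {c} → Terminal C c → Terminal D (f c)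
  terminal-map t q o = let (a , oa , _) = lift-opt o in t a oa

module OptionPreservingMap {C D : OptionGraph} {f : Pos C → Pos D}
  (op : OptionPreserving C D f) where

  map-opt : ∀ {p a} → Opt C p a → Opt D (f p) (f a)
  map-opt {p} {a} o = Equivalence.from (op p (f a)) (a , o , refl)

  lift-opt : ∀ {p q} → Opt D (f p) q → Image f (Opt C p) q
  lift-opt {p} {q} = Equivalence.to (op p q)

  open OptionMap {C} {D} {f} map-opt
  open OptionLift {C} {D} {f} lift-opt

  infiniteWalk-⇔ : ∀ c → InfiniteWalkFrom C c ⇔ InfiniteWalkFrom D (f c)
  infiniteWalk-⇔ c = mk⇔ infiniteWalk-map infiniteWalk-lift

  hasTerminalSubposition-⇔ : ∀ c → HasTerminalSubposition C c ⇔ HasTerminalSubposition D (f c)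
  hasTerminalSubposition-⇔ c = mk⇔
    (λ (q , r , t) → f q , reach-map r , terminal-map t)
    (λ (q , r , t) → let (a , ra , fa≡q) = reach-lift refl r in
      a , ra , terminal-reflect fa≡q t)

  Fset-⇔ : ∀ c → Fset C c ⇔ Fset D (f c)
  Fset-⇔ c = ¬-cong-⇔ (infiniteWalk-⇔ c)

  Iset-⇔ : ∀ c → Iset C c ⇔ Iset D (f c)
  Iset-⇔ c = ¬-cong-⇔ (hasTerminalSubposition-⇔ c)

  Mset-⇔ : ∀ c → Mset C c ⇔ Mset D (f c)
  Mset-⇔ c = ¬-cong-⇔ (Fset-⇔ c) ×-⇔ ¬-cong-⇔ (Iset-⇔ c)

mainTheorem5 : (C D : OptionGraph) (f : Pos C → Pos D)
    → OptionPreserving C D f → Surjective f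
    → (Image f (Fset C) ≐ Fset D) × (Image f (Iset C) ≐ Iset D) × (Image f (Mset C) ≐ Mset D)
mainTheorem5 C D f op surj =
  surjective⇒image-preimage surj Fset-⇔ ,
  surjective⇒image-preimage surj Iset-⇔ ,
  surjective⇒image-preimage surj Mset-⇔
  where open OptionPreservingMap {C} {D} {f} op
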